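{- Let $p,q$ be distinct propositional variables. The sequent \[ \mathbf{0} / (\mathbf{0} / p),\ \mathbf{0} / (\mathbf{0} / q) \to (\mathbf{0} / (\mathbf{0} / q)) \cdot (\mathbf{0} / (\mathbf{0} / p)) \] is true in every square R-model in which $\mathbf{0}$ is interpreted as the empty relation ($v(\mathbf{0}) = \varnothing$), but it is not derivable (without hypotheses) in the calculus $\mathbf{L}^{\Lambda}\wedge\mathbf{0}\mathbf{1}$.
   Context: Formulae are built from a countable set of propositional variables and the constants $\mathbf{0}$ and $\mathbf{1}$ using the binary connectives $\cdot$ (product), $\backslash$ (left division), $/$ (right division) and $\wedge$ (intersection). A sequent is an expression $\Pi \to B$ where $B$ is a formula and $\Pi$ is a finite, possibly empty, sequence of formulae (the empty sequence is written $\Lambda$). The calculus $\mathbf{L}^{\Lambda}\wedge\mathbf{0}\mathbf{1}$ has the axioms $A \to A$, $\Gamma,\mathbf{0},\Delta \to C$ and $\Lambda \to \mathbf{1}$, and the following rules (capital Greek letters denote possibly empty sequences of formulae): (Cut) from $\Pi \to A$ and $\Gamma, A, \Delta \to C$ infer $\Gamma,\Pi,\Delta\to C$; ($\backslash L$) from $\Pi\to A$ and $\Gamma,B,\Delta\to C$ infer $\Gamma,\Pi,A\backslash B,\Delta\to C$; ($\backslash R$) from $A,\Pi\to B$ infer $\Pi\to A\backslash B$; ($/ L$) from $\Pi\to A$ and $\Gamma,B,\Delta\to C$ infer $\Gamma,B/A,\Pi,\Delta\to C$; ($/R$) from $\Pi,A\to B$ infer $\Pi\to B/A$; ($\cdot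 L$) from $\Gamma,A,B,\Delta\to C$ infer $\Gamma,A\cdot B,\Delta\to C$; ($\cdot R$) from $\Pi\to A$ and $\Delta\to B$ infer $\Pi,\Delta\to A\cdot B$; ($\wedge L$) from $\Gamma,A,\Delta\to C$ infer both $\Gamma,A\wedge B,\Delta\to C$ and $\Gamma,B\wedge A,\Delta\to C$; ($\wedge R$) from $\Pi\to A$ and $\Pi\to B$ infer $\Pi\to A\wedge B$; ($\mathbf{1} L$) from $\Gamma,\Delta\to C$ infer $\Gamma,\mathbf{1},\Delta\to C$. For binary relations $R,S$ on a non-empty set $W$: $R\circ S=\{(x,z) \mid \exists y\in W\,((x,y)\in R \text{ and } (y,z)\in S)\}$; $R\backslash S=\{(y,z)\in W\times W \mid \forall x\in W\,((x,y)\in R\Rightarrow (x,z)\in S)\}$; $S/R=\{(x,y)\in W\times W \mid \forall z\in W\,((y,z)\in R\Rightarrow(x,z)\in S)\}$; $\delta=\{(x,x)\mid x\in W\}$. A square R-model is a pair $(W,v)$ with $W$ non-empty and $v$ assigning to each formula a binary relation on $W$ such that $v(A\cdot B)=v(A)\circ v(B)$, $v(A\backslash B)=v(A)\backslash v(B)$, $v(B/A)=v(B)/v(A)$, $v(A\wedge B)=v(A)\cap v(B)$ (values of variables and here of $\mathbf{0}$ being arbitrary subject to the stated interpretation). A sequent $A_1,\ldots,A_n\to B$ with $n\ge 1$ is true in the model if $v(A_1)\circ\cdots\circ v(A_n)\subseteq v(B)$; a sequent $\Lambda\to B$ is true if $\delta\subseteq v(B)$. -}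

module Defs where

open import Data.Nat using (ℕ)
open import Data.List using (List; []; _∷_; [_]; _++_)
open import Data.Product using (Σ; _×_; _,_)
open import Data.Empty using (⊥)
open import Relation.Binary.PropositionalEquality using (_≡_)

infixl 7 _·_
infixr 6 _＼_
infixl 6 _／_
infixl 5 _∧_

data Fm : Set where
  var  : ℕ → Fm
  𝟘    : Fm
  𝟙    : Fm
  _·_  : Fm → Fm → Fm
  _＼_ : Fm → Fm → Fm
  _／_ : Fm → Fm → Fm
  _∧_  : Fm → Fm → Fm

infix 3 _⊢_

data _⊢_ : List Fm → Fm → Set where
  ax   : ∀ {A} → [ A ] ⊢ A
  ax𝟘  : ∀ {Γ Δ C} → Γ ++ 𝟘 ∷ Δ ⊢ C
  ax𝟙  : [] ⊢ 𝟙
  cut  : ∀ {Π Γ Δ A C} → Π ⊢ A → Γ ++ A ∷ Δ ⊢ C → Γ ++ Π ++ Δ ⊢ C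
  ＼L  : ∀ {Π Γ Δ A B C} → Π ⊢ A → Γ ++ B ∷ Δ ⊢ C → Γ ++ Π ++ (A ＼ B) ∷ Δ ⊢ C
  ＼R  : ∀ {Π A B} → A ∷ Π ⊢ B → Π ⊢ A ＼ B
  ／L  : ∀ {Π Γ Δ A B C} → Π ⊢ A → Γ ++ B ∷ Δ ⊢ C → Γ ++ (B ／ A) ∷ Π ++ Δ ⊢ C
  ／R  : ∀ {Π A B} → Π ++ [ A ] ⊢ B → Π ⊢ B ／ A
  ·L   : ∀ {Γ Δ A B C} → Γ ++ A ∷ B ∷ Δ ⊢ C → Γ ++ (A · B) ∷ Δ ⊢ C
  ·R   : ∀ {Π Δ A B} → Π ⊢ A → Δ ⊢ B → Π ++ Δ ⊢ A · B
  ∧L₁  : ∀ {Γ Δ A B C} → Γ ++ A ∷ Δ ⊢ C → Γ ++ (A ∧ B) ∷ Δ ⊢ C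
  ∧L₂  : ∀ {Γ Δ A B C} → Γ ++ A ∷ Δ ⊢ C → Γ ++ (B ∧ A) ∷ Δ ⊢ C
  ∧R   : ∀ {Π A B} → Π ⊢ A → Π ⊢ B → Π ⊢ A ∧ B
  𝟙L   : ∀ {Γ Δ C} → Γ ++ Δ ⊢ C → Γ ++ 𝟙 ∷ Δ ⊢ C

Rel : Set → Set₁
Rel W = W → W → Set

module _ {W : Set} where

  _∘ʳ_ : Rel W → Rel W → Rel W
  (R ∘ʳ S) x z = Σ W λ y → R x y × S y z

  _＼ʳ_ : Rel W → Rel W → Rel W
  (R ＼ʳ S) y z = ∀ x → R x y → S x z

  _／ʳ_ : Rel W → Rel W → Rel W
  (S ／ʳ R) x y = ∀ z → R y z → S x z

  _∩ʳ_ : Rel W → Rel W → Rel W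
  (R ∩ʳ S) x y = R x y × S x y

  δ : Rel W
  δ x y = x ≡ y

  _⊆ʳ_ : Rel W → Rel W → Set
  R ⊆ʳ S = ∀ x y → R x y → S x y

-- Square R-models: non-empty W, arbitrary values of variables, of 𝟘
-- (and of 𝟙, which plays no role for the sequent at hand), extended
-- homomorphically to all formulae.

record SqModel : Set₁ where
  field
    W     : Set
    point : W
    vvar  : ℕ → Rel W
    v𝟘    : Rel W
    v𝟙    : Rel W

  v : Fm → Rel W
  v (var n) = vvar n
  v 𝟘       = v𝟘
  v 𝟙       = v𝟙
  v (A · B) = v A ∘ʳ v B
  v (A ＼ B) = v A ＼ʳ v B
  v (B ／ A) = v B ／ʳ v A
  v (A ∧ B) = v A ∩ʳ v B

  vSeq : List Fm → Rel W
  vSeq []           = δ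
  vSeq (A ∷ [])     = v A
  vSeq (A ∷ B ∷ Γ)  = v A ∘ʳ vSeq (B ∷ Γ)

  True : List Fm → Fm → Set
  True Γ B = vSeq Γ ⊆ʳ v B

  Empty𝟘 : Set
  Empty𝟘 = ∀ x y → v𝟘 x y → ⊥

open SqModel public

DN : Fm → Fm
DN A = 𝟘 ／ (𝟘 ／ A)

{-# OPTIONS --safe #-}
-- With v(𝟘) = ∅, the relation v(𝟘 ／ (𝟘 ／ A)) is either empty or total, so
-- any two such formulae commute in a square R-model.
--
-- For non-derivability, interpret formulae as sets of elements of a
-- relational monoid (𝟘 as ∅, 𝟙 as {e}, products and divisions pointwise);
-- the calculus is sound for this semantics.  In the partial monoid of words
-- over {a, b} without repeated letters, with p ↦ {a} and q ↦ {b}, the set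
-- 𝟘 ／ p consists of the words that cannot be followed by a, so
-- 𝟘 ／ (𝟘 ／ p) = {a, ab, ba} and 𝟘 ／ (𝟘 ／ q) = {b, ab, ba}.  The word ab is
-- then in the value of the antecedent but not in that of the succedent.
module Submission where

open import Defs
open import Data.Nat using (ℕ)
open import Data.List using (List; []; _∷_; [_]; _++_)
open import Data.List.Properties using (++-assoc)
open import Data.Product using (_×_; _,_; proj₁; proj₂; ∃-syntax)
open import Data.Sum using (_⊎_; inj₁; inj₂)
open import Data.Empty using (⊥-elim)
open import Function using (id)
open import Level using (0ℓ)
open import Relation.Nullary using (¬_)
open import Relation.Unary using (Pred; _⊆_; ∅; ｛_｝; _∩_)
open import Relation.Binary.PropositionalEquality
  using (_≡_; _≢_; refl; sym)

module _ (M : SqModel) (𝟘-empty : Empty𝟘 M) where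

  DN-constant : ∀ A {x y x′ y′} → v M (DN A) x y → v M (DN A) x′ y′
  DN-constant A h z k =
    ⊥-elim (𝟘-empty _ _ (h z (λ w a → ⊥-elim (𝟘-empty _ _ (k w a)))))

  DN-comm : ∀ A B → True M (DN A ∷ DN B ∷ []) (DN B · DN A)
  DN-comm A B x z (y , hA , hB) = y , DN-constant B hB , DN-constant A hA

record RelationalMonoid : Set₁ where
  infix 4 _∙_↦_
  field
    Carrier          : Set
    _∙_↦_            : Carrier → Carrier → Carrier → Set
    e                : Carrier
    identityˡ        : ∀ {x} → e ∙ x ↦ x
    identityʳ        : ∀ {x} → x ∙ e ↦ x
    identityˡ-unique : ∀ {x m} → e ∙ x ↦ m → x ≡ m
    identityʳ-unique : ∀ {x m} → x ∙ e ↦ m → x ≡ m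
    reassocˡ         : ∀ {x s t r m} → x ∙ r ↦ m → s ∙ t ↦ r →
                       ∃[ u ] x ∙ s ↦ u × u ∙ t ↦ m
    reassocʳ         : ∀ {x s t u m} → x ∙ s ↦ u → u ∙ t ↦ m →
                       ∃[ r ] s ∙ t ↦ r × x ∙ r ↦ m

module Semantics (M : RelationalMonoid)
                 (⟦_⟧ᵛ : ℕ → Pred (RelationalMonoid.Carrier M) 0ℓ) where

  open RelationalMonoid M

  Subset : Set₁
  Subset = Pred Carrier 0ℓ

  infixl 7 _⊙_
  infixr 6 _＼ᵖ_
  infixl 6 _／ᵖ_

  _⊙_ : Subset → Subset → Subset
  (P ⊙ Q) m = ∃[ x ] ∃[ y ] x ∙ y ↦ m × P x × Q y

  _＼ᵖ_ : Subset → Subset → Subset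
  (P ＼ᵖ Q) y = ∀ {x m} → x ∙ y ↦ m → P x → Q m

  _／ᵖ_ : Subset → Subset → Subset
  (Q ／ᵖ P) x = ∀ {y m} → x ∙ y ↦ m → P y → Q m

  ⟦_⟧ : Fm → Subset
  ⟦ var n ⟧ = ⟦ n ⟧ᵛ
  ⟦ 𝟘 ⟧     = ∅
  ⟦ 𝟙 ⟧     = ｛ e ｝
  ⟦ A · B ⟧ = ⟦ A ⟧ ⊙ ⟦ B ⟧
  ⟦ A ＼ B ⟧ = ⟦ A ⟧ ＼ᵖ ⟦ B ⟧
  ⟦ B ／ A ⟧ = ⟦ B ⟧ ／ᵖ ⟦ A ⟧
  ⟦ A ∧ B ⟧ = ⟦ A ⟧ ∩ ⟦ B ⟧

  ⟦_⟧* : List Fm → Subset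
  ⟦ [] ⟧*    = ｛ e ｝
  ⟦ A ∷ Γ ⟧* = ⟦ A ⟧ ⊙ ⟦ Γ ⟧*

  variable
    P P′ Q Q′ S : Subset

  ⊙-mono : P ⊆ P′ → Q ⊆ Q′ → P ⊙ Q ⊆ P′ ⊙ Q′
  ⊙-mono f g (x , y , r , px , qy) = x , y , r , f px , g qy

  ⊙-assocˡ : P ⊙ (Q ⊙ S) ⊆ P ⊙ Q ⊙ S
  ⊙-assocˡ (x , r , xr , px , (s , t , st , qs , st′)) with reassocˡ xr st
  ... | u , xs , ut = u , t , ut , (x , s , xs , px , qs) , st′

  ⊙-assocʳ : P ⊙ Q ⊙ S ⊆ P ⊙ (Q ⊙ S)
  ⊙-assocʳ (u , t , ut , (x , s , xs , px , qs) , st′) with reassocʳ xs ut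
  ... | r , st , xr = x , r , xr , px , (s , t , st , qs , st′)

  ⊙-identityˡ⁺ : P ⊆ ｛ e ｝ ⊙ P
  ⊙-identityˡ⁺ px = e , _ , identityˡ , refl , px

  ⊙-identityˡ⁻ : ｛ e ｝ ⊙ P ⊆ P
  ⊙-identityˡ⁻ (_ , y , r , refl , py) with identityˡ-unique r
  ... | refl = py

  ⊙-identityʳ⁺ : P ⊆ P ⊙ ｛ e ｝
  ⊙-identityʳ⁺ px = _ , e , identityʳ , px , refl

  ⊙-identityʳ⁻ : P ⊙ ｛ e ｝ ⊆ P
  ⊙-identityʳ⁻ (x , _ , r , px , refl) with identityʳ-unique r
  ... | refl = px

  ＼ᵖ-elim : P ⊙ (P ＼ᵖ Q) ⊆ Q
  ＼ᵖ-elim (x , y , r , px , f) = f r px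

  ＼ᵖ-intro : P ⊙ Q ⊆ S → Q ⊆ P ＼ᵖ S
  ＼ᵖ-intro f qy r px = f (_ , _ , r , px , qy)

  ／ᵖ-elim : (Q ／ᵖ P) ⊙ P ⊆ Q
  ／ᵖ-elim (x , y , r , f , py) = f r py

  ／ᵖ-intro : P ⊙ Q ⊆ S → P ⊆ S ／ᵖ Q
  ／ᵖ-intro f px r qy = f (_ , _ , r , px , qy)

  ⟦++⟧⁻ : ∀ Γ Δ → ⟦ Γ ++ Δ ⟧* ⊆ ⟦ Γ ⟧* ⊙ ⟦ Δ ⟧*
  ⟦++⟧⁻ []      Δ h = ⊙-identityˡ⁺ h
  ⟦++⟧⁻ (A ∷ Γ) Δ h = ⊙-assocˡ (⊙-mono id (⟦++⟧⁻ Γ Δ) h)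

  ⟦++⟧⁺ : ∀ Γ Δ → ⟦ Γ ⟧* ⊙ ⟦ Δ ⟧* ⊆ ⟦ Γ ++ Δ ⟧*
  ⟦++⟧⁺ []      Δ h = ⊙-identityˡ⁻ h
  ⟦++⟧⁺ (A ∷ Γ) Δ h = ⊙-mono id (⟦++⟧⁺ Γ Δ) (⊙-assocʳ h)

  ⟦⟧*-infix-mono : ∀ Γ Σ Σ′ Δ → ⟦ Σ ⟧* ⊆ ⟦ Σ′ ⟧* →
                   ⟦ Γ ++ Σ ++ Δ ⟧* ⊆ ⟦ Γ ++ Σ′ ++ Δ ⟧*
  ⟦⟧*-infix-mono Γ Σ Σ′ Δ f h =
    ⟦++⟧⁺ Γ (Σ′ ++ Δ) (⊙-mono id inner (⟦++⟧⁻ Γ (Σ ++ Δ) h))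
    where
    inner : ⟦ Σ ++ Δ ⟧* ⊆ ⟦ Σ′ ++ Δ ⟧*
    inner h′ = ⟦++⟧⁺ Σ′ Δ (⊙-mono f id (⟦++⟧⁻ Σ Δ h′))

  sound : ∀ {Γ C} → Γ ⊢ C → ⟦ Γ ⟧* ⊆ ⟦ C ⟧
  sound ax = ⊙-identityʳ⁻
  sound (ax𝟘 {Γ} {Δ}) h with ⟦++⟧⁻ Γ (𝟘 ∷ Δ) h
  ... | _ , _ , _ , _ , _ , _ , _ , () , _
  sound ax𝟙 h = h
  sound (cut {Π} {Γ} {Δ} {A} d₁ d₂) h =
    sound d₂ (⟦⟧*-infix-mono Γ Π [ A ] Δ (λ h′ → ⊙-identityʳ⁺ (sound d₁ h′)) h)
  sound (＼L {Π} {Γ} {Δ} {A} {B} d₁ d₂) h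
    rewrite sym (++-assoc Π [ A ＼ B ] Δ) =
    sound d₂ (⟦⟧*-infix-mono Γ (Π ++ [ A ＼ B ]) [ B ] Δ apply h)
    where
    apply : ⟦ Π ++ [ A ＼ B ] ⟧* ⊆ ⟦ [ B ] ⟧*
    apply h′ = ⊙-identityʳ⁺
      (＼ᵖ-elim (⊙-mono (sound d₁) ⊙-identityʳ⁻ (⟦++⟧⁻ Π [ A ＼ B ] h′)))
  sound (＼R d) = ＼ᵖ-intro (sound d)
  sound (／L {Π} {Γ} {Δ} {A} {B} d₁ d₂) h =
    sound d₂ (⟦⟧*-infix-mono Γ (B ／ A ∷ Π) [ B ] Δ
      (λ h′ → ⊙-identityʳ⁺ (／ᵖ-elim (⊙-mono id (sound d₁) h′))) h)
  sound (／R {Π} {A} d) =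
    ／ᵖ-intro (λ h → sound d (⟦++⟧⁺ Π [ A ] (⊙-mono id ⊙-identityʳ⁺ h)))
  sound (·L {Γ} {Δ} {A} {B} d) h =
    sound d (⟦⟧*-infix-mono Γ [ A · B ] (A ∷ B ∷ []) Δ ⊙-assocʳ h)
  sound (·R {Π} {Δ} d₁ d₂) h = ⊙-mono (sound d₁) (sound d₂) (⟦++⟧⁻ Π Δ h)
  sound (∧L₁ {Γ} {Δ} {A} {B} d) h =
    sound d (⟦⟧*-infix-mono Γ [ A ∧ B ] [ A ] Δ (⊙-mono proj₁ id) h)
  sound (∧L₂ {Γ} {Δ} {A} {B} d) h =
    sound d (⟦⟧*-infix-mono Γ [ B ∧ A ] [ A ] Δ (⊙-mono proj₂ id) h)
  sound (∧R d₁ d₂) h = sound d₁ h , sound d₂ h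
  sound (𝟙L {Γ} {Δ} d) h = sound d (⟦⟧*-infix-mono Γ [ 𝟙 ] [] Δ ⊙-identityʳ⁻ h)

module Words where

  data Word : Set where
    ε a b ab ba : Word

  infix 4 _∙_↦_

  data _∙_↦_ : Word → Word → Word → Set where
    ε∙  : ∀ {x} → ε ∙ x ↦ x
    ∙ε  : ∀ {x} → x ∙ ε ↦ x
    a∙b : a ∙ b ↦ ab
    b∙a : b ∙ a ↦ ba

  ε∙-unique : ∀ {x m} → ε ∙ x ↦ m → x ≡ m
  ε∙-unique ε∙ = refl
  ε∙-unique ∙ε = refl

  ∙ε-unique : ∀ {x m} → x ∙ ε ↦ m → x ≡ m
  ∙ε-unique ε∙ = refl
  ∙ε-unique ∙ε = refl

  reassocˡ : ∀ {x s t r m} → x ∙ r ↦ m → s ∙ t ↦ r → ∃[ u ] x ∙ s ↦ u × u ∙ t ↦ m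
  reassocˡ ε∙  st  = _ , ε∙ , st
  reassocˡ ∙ε  ε∙  = _ , ∙ε , ∙ε
  reassocˡ ∙ε  ∙ε  = _ , ∙ε , ∙ε
  reassocˡ a∙b ε∙  = a , ∙ε , a∙b
  reassocˡ a∙b ∙ε  = ab , a∙b , ∙ε
  reassocˡ b∙a ε∙  = b , ∙ε , b∙a
  reassocˡ b∙a ∙ε  = ba , b∙a , ∙ε

  reassocʳ : ∀ {x s t u m} → x ∙ s ↦ u → u ∙ t ↦ m → ∃[ r ] s ∙ t ↦ r × x ∙ r ↦ m
  reassocʳ xs  ∙ε  = _ , ∙ε , xs
  reassocʳ ε∙  ε∙  = _ , ε∙ , ε∙
  reassocʳ ∙ε  ε∙  = _ , ε∙ , ε∙
  reassocʳ ε∙  a∙b = ab , a∙b , ε∙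
  reassocʳ ∙ε  a∙b = b , ε∙ , a∙b
  reassocʳ ε∙  b∙a = ba , b∙a , ε∙
  reassocʳ ∙ε  b∙a = a , ε∙ , b∙a

  words : RelationalMonoid
  words = record
    { Carrier          = Word
    ; _∙_↦_            = _∙_↦_
    ; e                = ε
    ; identityˡ        = ε∙
    ; identityʳ        = ∙ε
    ; identityˡ-unique = ε∙-unique
    ; identityʳ-unique = ∙ε-unique
    ; reassocˡ         = reassocˡ
    ; reassocʳ         = reassocʳ
    }

module Countermodel (p q : ℕ) (p≢q : p ≢ q) where

  open Words

  ⟦_⟧ᵛ : ℕ → Pred Word 0ℓ
  ⟦ n ⟧ᵛ w = (n ≡ p × w ≡ a) ⊎ (n ≡ q × w ≡ b)

  open Semantics words ⟦_⟧ᵛ using (⟦_⟧; ⟦_⟧*; sound)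

  var-nonunit : ∀ {n w} → ⟦ var n ⟧ w → w ≢ ε
  var-nonunit (inj₁ (_ , refl)) ()
  var-nonunit (inj₂ (_ , refl)) ()

  q-only : ∀ {w} → ⟦ var q ⟧ w → w ≡ b
  q-only (inj₁ (q≡p , _)) = ⊥-elim (p≢q (sym q≡p))
  q-only (inj₂ (_ , w≡b)) = w≡b

  𝟘／var-at-ab : ∀ n → ⟦ 𝟘 ／ var n ⟧ ab
  𝟘／var-at-ab n ∙ε h = var-nonunit h refl

  𝟘／q-at-b : ⟦ 𝟘 ／ var q ⟧ b
  𝟘／q-at-b ∙ε  h = var-nonunit h refl
  𝟘／q-at-b b∙a h with q-only h
  ... | ()

  DN-at-ε : ∀ n → ¬ ⟦ DN (var n) ⟧ ε
  DN-at-ε n dn = dn ε∙ (𝟘／var-at-ab n)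

  DNq-at-a : ¬ ⟦ DN (var q) ⟧ a
  DNq-at-a dn = dn a∙b 𝟘／q-at-b

  DNp-at-a : ⟦ DN (var p) ⟧ a
  DNp-at-a ∙ε  ¬ε∙a = ¬ε∙a ε∙ (inj₁ (refl , refl))
  DNp-at-a a∙b ¬b∙a = ¬b∙a b∙a (inj₁ (refl , refl))

  DNq-at-b : ⟦ DN (var q) ⟧ b
  DNq-at-b ∙ε  ¬ε∙b = ¬ε∙b ε∙ (inj₂ (refl , refl))
  DNq-at-b b∙a ¬a∙b = ¬a∙b a∙b (inj₂ (refl , refl))

  ab∉DNq·DNp : ¬ ⟦ DN (var q) · DN (var p) ⟧ ab
  ab∉DNq·DNp (_ , _ , ε∙  , dq , _)  = DN-at-ε q dq
  ab∉DNq·DNp (_ , _ , ∙ε  , _  , dp) = DN-at-ε p dp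
  ab∉DNq·DNp (_ , _ , a∙b , dq , _)  = DNq-at-a dq

  underivable : ¬ (DN (var p) ∷ DN (var q) ∷ [] ⊢ DN (var q) · DN (var p))
  underivable d =
    ab∉DNq·DNp (sound d (a , b , a∙b , DNp-at-a , (b , ε , ∙ε , DNq-at-b , refl)))

proposition2p1 : (p q : ℕ) → p ≢ q →
    ((M : SqModel) → Empty𝟘 M →
      True M (DN (var p) ∷ DN (var q) ∷ []) (DN (var q) · DN (var p)))
    × ¬ ((DN (var p) ∷ DN (var q) ∷ []) ⊢ (DN (var q) · DN (var p)))
proposition2p1 p q p≢q =
  (λ M 𝟘-empty → DN-comm M 𝟘-empty (var p) (var q)) , Countermodel.underivable p q p≢q
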